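{- Every DAG in $\mathscr{F}_{n,3}$ can be obtained by performing a finite sequence of interchange operations starting from the DAG $G_0$ with vertex set $[n+1]$ and edge multiset consisting of two copies of $(i,i+1)$ for each $i\in[n]$ together with the edge $(1,n+1)$.
   Context: DAGs have vertex set $[n+1]$ and a multiset of edges $(i,j)$ with $i<j$ (parallel edges allowed), identified with their edge multisets. $\mathscr{F}_{n,3}$ is the set of such DAGs with out-degree sequence $(3,2,\dots,2,0)$ and in-degree sequence $(0,2,\dots,2,3)$. Given edges $(a,d),(b,c)$ with $a<b<c<d$ (a nested pair), the interchange operation replaces them by $(a,c),(b,d)$, leaving all other edges unchanged. -}

module Defs where

open import Data.Nat using (ℕ; zero; suc; _≤_; _<_; _≟_)
open import Data.Product using (_×_; _,_; proj₁; proj₂; Σ; ∃-syntax)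
open import Data.List using (List; []; _∷_; length; filter; concatMap; upTo)
open import Data.List.Relation.Unary.All using (All)
open import Data.List.Relation.Binary.Permutation.Propositional using (_↭_)
open import Relation.Binary.PropositionalEquality using (_≡_)
open import Relation.Binary.Construct.Closure.ReflexiveTransitive using (Star)

-- Vertices are 1, 2, …, n+1 (as natural numbers).
-- An edge (i , j) goes from i to j.
Edge : Set
Edge = ℕ × ℕ

-- A DAG is identified with its edge multiset, represented as a list of
-- edges considered up to permutation (_↭_).
EdgeList : Set
EdgeList = List Edge

WellFormed : ℕ → EdgeList → Set
WellFormed n E = All (λ e → (1 ≤ proj₁ e) × (proj₁ e < proj₂ e) × (proj₂ e ≤ suc n)) E

outdeg : EdgeList → ℕ → ℕ
outdeg E v = length (filter (λ e → proj₁ e ≟ v) E)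

indeg : EdgeList → ℕ → ℕ
indeg E v = length (filter (λ e → proj₂ e ≟ v) E)

InF3 : ℕ → EdgeList → Set
InF3 n E =
  WellFormed n E ×
  (outdeg E 1 ≡ 3) × ((v : ℕ) → 2 ≤ v → v ≤ n → outdeg E v ≡ 2) × (outdeg E (suc n) ≡ 0) ×
  (indeg E 1 ≡ 0) × ((v : ℕ) → 2 ≤ v → v ≤ n → indeg E v ≡ 2) × (indeg E (suc n) ≡ 3)

Interchange : EdgeList → EdgeList → Set
Interchange G H =
  ∃[ a ] ∃[ b ] ∃[ c ] ∃[ d ] ∃[ rest ]
    (a < b) × (b < c) × (c < d) ×
    (G ↭ ((a , d) ∷ (b , c) ∷ rest)) ×
    (H ↭ ((a , c) ∷ (b , d) ∷ rest))

Reachable : EdgeList → EdgeList → Set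
Reachable G H = Σ EdgeList (λ K → Star Interchange G K × (K ↭ H))

G₀ : ℕ → EdgeList
G₀ n = (1 , suc n) ∷ concatMap (λ i → (suc i , suc (suc i)) ∷ (suc i , suc (suc i)) ∷ []) (upTo n)

-- The potential Σ i·j over the edges (i , j) strictly increases under an
-- interchange, since a·c + b·d − (a·d + b·c) = (b − a)(d − c) > 0, and
-- reversing an interchange preserves all degrees. So it suffices to show that
-- every E ∈ 𝓕_{n,3} other than G₀ is the result of an interchange, i.e.
-- contains edges (1 , k) and (b , m) with 1 < b < k < m. Vertex 1 has an
-- out-edge (1 , k) with k > 2 unless n = 1. Walking along i = 1, 2, …, every
-- vertex i + 1 < k receives its two edges from i, which exhausts the
-- out-degree of i. When i + 1 = k ≤ n, vertex k still has only one in-edge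
-- besides (1 , k), so the second out-edge (i , m) of i jumps over k; if the
-- walk reaches k = n + 1 instead, E is G₀.
module Submission where

open import Defs
open import Data.Nat using (ℕ; zero; suc; _+_; _*_; _≤_; _<_; z≤n; s≤s; z<s; _≟_; _≡ᵇ_)
open import Data.Nat.Properties
open import Data.Nat.ListAction using (sum)
open import Data.Nat.ListAction.Properties using (sum-↭)
open import Data.Nat.Solver using (module +-*-Solver)
open import Data.Nat.Induction using (<-wellFounded)
open import Data.List using ([]; _∷_; length; filter; map; concatMap; applyUpTo)
open import Data.List.Relation.Unary.All as All using (All; []; _∷_)
open import Data.List.Relation.Binary.Permutation.Propositional
  using (_↭_; prep; swap; ↭-refl; ↭-sym; ↭-trans)
open import Data.List.Relation.Binary.Permutation.Propositional.Properties
  using (All-resp-↭; filter-↭; ↭-length; map⁺; shift)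
open import Data.Product using (_×_; _,_; proj₁; proj₂; ∃-syntax)
open import Data.Sum using (_⊎_; inj₁; inj₂)
open import Data.Empty using (⊥-elim)
open import Data.Bool using (true; false; if_then_else_)
open import Function using (_∘_)
open import Induction.WellFounded using (Acc; acc)
open import Relation.Nullary using (yes; no)
open import Relation.Binary.PropositionalEquality
  using (_≡_; _≢_; refl; sym; trans; cong; subst; module ≡-Reasoning)
open import Relation.Binary.Construct.Closure.ReflexiveTransitive using (ε; _◅_; _◅◅_)

degree : (Edge → ℕ) → ℕ → EdgeList → ℕ
degree f v R = length (filter (λ e → f e ≟ v) R)

δ : ℕ → ℕ → ℕ
δ s v = if s ≡ᵇ v then 1 else 0

degree-∷ : ∀ f v x R → degree f v (x ∷ R) ≡ δ (f x) v + degree f v R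
degree-∷ f v x R with f x ≡ᵇ v
... | true  = refl
... | false = refl

degree-∷-≡ : ∀ {f v x} R → f x ≡ v → degree f v (x ∷ R) ≡ suc (degree f v R)
degree-∷-≡ {f} {v} {x} R fx≡v with f x ≡ᵇ v | ≡⇒≡ᵇ (f x) v fx≡v
... | true | _ = refl

degree-∷-≢ : ∀ {f v x} R → f x ≢ v → degree f v (x ∷ R) ≡ degree f v R
degree-∷-≢ {f} {v} {x} R fx≢v with f x ≡ᵇ v | ≡ᵇ⇒≡ (f x) v
... | true  | fx≡v = ⊥-elim (fx≢v (fx≡v _))
... | false | _    = refl

degree-↭ : ∀ f v {R S} → R ↭ S → degree f v R ≡ degree f v S
degree-↭ f v p = ↭-length (filter-↭ (λ e → f e ≟ v) p)

degree-↭-∷-≡ : ∀ {f v x R R′} → R ↭ x ∷ R′ → f x ≡ v → degree f v R ≡ suc (degree f v R′)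
degree-↭-∷-≡ {f} {v} {R′ = R′} p fx≡v = trans (degree-↭ f v p) (degree-∷-≡ R′ fx≡v)

degree-↭-∷-≢ : ∀ {f v x R R′} → R ↭ x ∷ R′ → f x ≢ v → degree f v R ≡ degree f v R′
degree-↭-∷-≢ {f} {v} {R′ = R′} p fx≢v = trans (degree-↭ f v p) (degree-∷-≢ R′ fx≢v)

degree-↭-∷∷-≡ : ∀ {f v x R R′} → R ↭ x ∷ x ∷ R′ → f x ≡ v →
                degree f v R ≡ suc (suc (degree f v R′))
degree-↭-∷∷-≡ {R′ = R′} p fx≡v = trans (degree-↭-∷-≡ p fx≡v) (cong suc (degree-∷-≡ R′ fx≡v))

degree-↭-∷∷-≢ : ∀ {f v x R R′} → R ↭ x ∷ x ∷ R′ → f x ≢ v → degree f v R ≡ degree f v R′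
degree-↭-∷∷-≢ {R′ = R′} p fx≢v = trans (degree-↭-∷-≢ p fx≢v) (degree-∷-≢ R′ fx≢v)

degree≡0⇒≢ : ∀ {f v x R R′} → degree f v R ≡ 0 → R ↭ x ∷ R′ → f x ≢ v
degree≡0⇒≢ deg≡0 p fx≡v = 0≢1+n (trans (sym deg≡0) (degree-↭-∷-≡ p fx≡v))

degree-suc-inv : ∀ f v R {c} → degree f v R ≡ suc c →
                 ∃[ x ] ∃[ R′ ] (f x ≡ v) × (R ↭ x ∷ R′)
degree-suc-inv f v (x ∷ R) deg≡ with f x ≟ v
... | yes fx≡v = x , R , fx≡v , ↭-refl
... | no fx≢v with degree-suc-inv f v R (trans (sym (degree-∷-≢ R fx≢v)) deg≡)
...   | y , R′ , fy≡v , p = y , x ∷ R′ , fy≡v , ↭-trans (prep x p) (swap x y ↭-refl)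

All-↭-∷⁻ : ∀ {P : Edge → Set} {x R R′} → R ↭ x ∷ R′ → All P R → P x × All P R′
All-↭-∷⁻ p = All.uncons ∘ All-resp-↭ p

All-↭-∷∷⁻ : ∀ {P : Edge → Set} {x y R R′} → R ↭ x ∷ y ∷ R′ → All P R → All P R′
All-↭-∷∷⁻ p = All.tail ∘ All.tail ∘ All-resp-↭ p

Ascending : EdgeList → Set
Ascending = All (λ e → proj₁ e < proj₂ e)

SourcesFrom : ℕ → EdgeList → Set
SourcesFrom i = All (λ e → i ≤ proj₁ e)

ascending : ∀ {n R} → WellFormed n R → Ascending R
ascending = All.map (proj₁ ∘ proj₂)

sourcesFrom-suc : ∀ i R → SourcesFrom i R → outdeg R i ≡ 0 → SourcesFrom (suc i) R
sourcesFrom-suc i []      []         _      = []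
sourcesFrom-suc i (x ∷ R) (i≤x ∷ S) deg≡0 =
  ≤∧≢⇒< i≤x (λ i≡x → degree≡0⇒≢ {f = proj₁} deg≡0 ↭-refl (sym i≡x))
  ∷ sourcesFrom-suc i R S (m+n≡0⇒n≡0 (δ (proj₁ x) i) (trans (sym (degree-∷ proj₁ i x R)) deg≡0))

wellFormed-empty : ∀ n R → SourcesFrom (suc n) R → WellFormed n R → R ≡ []
wellFormed-empty n []      _            _                     = refl
wellFormed-empty n (x ∷ R) (n<x₁ ∷ _) ((_ , x₁<x₂ , x₂≤) ∷ _) =
  ⊥-elim (<-irrefl refl (≤-<-trans n<x₁ (<-≤-trans x₁<x₂ x₂≤)))

-- The only possible edge into i + 1 from sources ≥ i is (i , i + 1).
peel-edge : ∀ {i c R} → SourcesFrom i R → Ascending R → indeg R (suc i) ≡ suc c →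
            ∃[ R′ ] (R ↭ (i , suc i) ∷ R′) × (indeg R′ (suc i) ≡ c)
peel-edge {i} {R = R} S A deg≡ with degree-suc-inv proj₂ (suc i) R deg≡
... | (s , t) , R′ , refl , p with All-↭-∷⁻ p S | All-↭-∷⁻ p A
...   | i≤s , _ | s<t , _ with ≤-antisym (≤-pred s<t) i≤s
...     | refl = R′ , p , suc-injective (trans (sym (degree-↭-∷-≡ p refl)) deg≡)

peel-two-edges : ∀ {i c R} → SourcesFrom i R → Ascending R → indeg R (suc i) ≡ suc (suc c) →
                 ∃[ R′ ] (R ↭ (i , suc i) ∷ (i , suc i) ∷ R′)
peel-two-edges S A deg≡ with peel-edge S A deg≡
... | R₁ , p₁ , deg₁≡ with peel-edge (proj₂ (All-↭-∷⁻ p₁ S)) (proj₂ (All-↭-∷⁻ p₁ A)) deg₁≡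
...   | R₂ , p₂ , _ = R₂ , ↭-trans p₁ (prep _ p₂)

doubledPath : ℕ → ℕ → EdgeList
doubledPath i zero    = []
doubledPath i (suc t) = (i , suc i) ∷ (i , suc i) ∷ doubledPath (suc i) t

concatMap-applyUpTo≡doubledPath : ∀ (g : ℕ → ℕ) s t → (∀ x → g x ≡ s + x) →
  concatMap (λ i → (suc i , suc (suc i)) ∷ (suc i , suc (suc i)) ∷ []) (applyUpTo g t)
  ≡ doubledPath (suc s) t
concatMap-applyUpTo≡doubledPath g s zero    g≗s+ = refl
concatMap-applyUpTo≡doubledPath g s (suc t) g≗s+ rewrite g≗s+ 0 | +-identityʳ s =
  cong (λ L → (suc s , suc (suc s)) ∷ (suc s , suc (suc s)) ∷ L)
    (concatMap-applyUpTo≡doubledPath (g ∘ suc) (suc s) t (λ x → trans (g≗s+ (suc x)) (+-suc s x)))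

G₀≡doubledPath : ∀ n → G₀ n ≡ (1 , suc n) ∷ doubledPath 1 n
G₀≡doubledPath n = cong ((1 , suc n) ∷_) (concatMap-applyUpTo≡doubledPath (λ x → x) 0 n (λ _ → refl))

-- What remains of some E ∈ 𝓕_{n,3} after deleting an out-edge (1 , k) of
-- vertex 1 and the doubled path from 1 to i.
record Walk (n k i : ℕ) (R : EdgeList) : Set where
  field
    wellFormed  : WellFormed n R
    sourcesFrom : SourcesFrom i R
    outdeg≡2    : ∀ v → i ≤ v → v ≤ n → outdeg R v ≡ 2
    indeg≡2     : ∀ v → i < v → v < k → indeg R v ≡ 2
    indeg-inner : k ≤ n → indeg R k ≡ 1
    indeg-last  : k ≡ suc n → indeg R k ≡ 2

open Walk

Crossing : ℕ → EdgeList → Set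
Crossing k R = ∃[ b ] ∃[ m ] ∃[ rest ] (suc b ≡ k) × (k < m) × (R ↭ (b , m) ∷ rest)

walk-start : ∀ {n k R E} → InF3 n E → E ↭ (1 , k) ∷ R → Walk n k 1 R
walk-start {n} {k} {R} (wf , out₁ , out , _ , _ , in′ , inₙ) p = record
  { wellFormed  = wfR
  ; sourcesFrom = All.map proj₁ wfR
  ; outdeg≡2    = outdeg≡2′
  ; indeg≡2     = λ v 1<v v<k →
      trans (sym (degree-↭-∷-≢ p (>⇒≢ v<k))) (in′ v 1<v (≤-pred (<-≤-trans v<k k≤)))
  ; indeg-inner = λ k≤n → suc-injective (trans (sym (degree-↭-∷-≡ p refl)) (in′ k 1<k k≤n))
  ; indeg-last  = λ { refl → suc-injective (trans (sym (degree-↭-∷-≡ p refl)) inₙ) }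
  }
  where
  1<k : 1 < k
  1<k = proj₁ (proj₂ (proj₁ (All-↭-∷⁻ p wf)))
  k≤ : k ≤ suc n
  k≤ = proj₂ (proj₂ (proj₁ (All-↭-∷⁻ p wf)))
  wfR : WellFormed n R
  wfR = proj₂ (All-↭-∷⁻ p wf)
  outdeg≡2′ : ∀ v → 1 ≤ v → v ≤ n → outdeg R v ≡ 2
  outdeg≡2′ v 1≤v v≤n with m≤n⇒m<n∨m≡n 1≤v
  ... | inj₁ 1<v = trans (sym (degree-↭-∷-≢ p (<⇒≢ 1<v))) (out v 1<v v≤n)
  ... | inj₂ refl = suc-injective (trans (sym (degree-↭-∷-≡ p refl)) out₁)

walk-step : ∀ {n k i R} → Walk n k i R → suc i < k → k ≤ suc n →
            ∃[ R′ ] (R ↭ (i , suc i) ∷ (i , suc i) ∷ R′) × Walk n k (suc i) R′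
walk-step {n} {i = i} W si<k k≤
  with peel-two-edges (sourcesFrom W) (ascending (wellFormed W)) (indeg≡2 W (suc i) ≤-refl si<k)
... | R′ , p = R′ , p , record
  { wellFormed  = wf′
  ; sourcesFrom = sourcesFrom-suc i R′ (All-↭-∷∷⁻ p (sourcesFrom W)) outdeg-i≡0
  ; outdeg≡2    = λ v i<v v≤n →
      trans (sym (degree-↭-∷∷-≢ p (<⇒≢ i<v))) (outdeg≡2 W v (<⇒≤ i<v) v≤n)
  ; indeg≡2     = λ v si<v v<k →
      trans (sym (degree-↭-∷∷-≢ p (<⇒≢ si<v))) (indeg≡2 W v (<-trans ≤-refl si<v) v<k)
  ; indeg-inner = λ k≤n → trans (sym (degree-↭-∷∷-≢ p (<⇒≢ si<k))) (indeg-inner W k≤n)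
  ; indeg-last  = λ k≡ → trans (sym (degree-↭-∷∷-≢ p (<⇒≢ si<k))) (indeg-last W k≡)
  }
  where
  wf′ : WellFormed n R′
  wf′ = All-↭-∷∷⁻ p (wellFormed W)
  i≤n : i ≤ n
  i≤n = ≤-pred (≤-trans (<-trans ≤-refl si<k) k≤)
  outdeg-i≡0 : outdeg R′ i ≡ 0
  outdeg-i≡0 = suc-injective (suc-injective
    (trans (sym (degree-↭-∷∷-≡ p refl)) (outdeg≡2 W i ≤-refl i≤n)))

walk-crossing : ∀ {n k i R} → Walk n k i R → suc i ≡ k → k ≤ n → Crossing k R
walk-crossing {k = k} {i} W refl k≤n
  with peel-edge (sourcesFrom W) (ascending (wellFormed W)) (indeg-inner W k≤n)
... | R₁ , p₁ , indeg₁≡0 with degree-suc-inv proj₁ i R₁ outdeg₁≡1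
  where
  outdeg₁≡1 : outdeg R₁ i ≡ 1
  outdeg₁≡1 = suc-injective (trans (sym (degree-↭-∷-≡ p₁ refl)) (outdeg≡2 W i ≤-refl (<⇒≤ k≤n)))
...   | (s , m) , R₂ , refl , p₂ =
  i , m , (i , suc i) ∷ R₂ , refl , k<m , ↭-trans p₁ (↭-trans (prep _ p₂) (swap _ _ ↭-refl))
  where
  i<m : i < m
  i<m = proj₁ (proj₂ (proj₁ (All-↭-∷⁻ p₂ (proj₂ (All-↭-∷⁻ p₁ (wellFormed W))))))
  k<m : k < m
  k<m = ≤∧≢⇒< i<m (λ k≡m → degree≡0⇒≢ indeg₁≡0 p₂ (sym k≡m))

walk-last : ∀ {n R} → Walk n (suc n) n R → R ↭ doubledPath n 1
walk-last {n} {R} W with peel-two-edges (sourcesFrom W) (ascending (wellFormed W)) (indeg-last W refl)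
... | R′ , p = subst (λ L → R ↭ (n , suc n) ∷ (n , suc n) ∷ L) R′≡[] p
  where
  outdeg-n≡0 : outdeg R′ n ≡ 0
  outdeg-n≡0 = suc-injective (suc-injective
    (trans (sym (degree-↭-∷∷-≡ p refl)) (outdeg≡2 W n ≤-refl ≤-refl)))
  R′≡[] : R′ ≡ []
  R′≡[] = wellFormed-empty n R′
    (sourcesFrom-suc n R′ (All-↭-∷∷⁻ p (sourcesFrom W)) outdeg-n≡0) (All-↭-∷∷⁻ p (wellFormed W))

walk : ∀ t {n k i R} → t + i ≡ n → i < k → k ≤ suc n → Walk n k i R →
       (k ≡ suc n × R ↭ doubledPath i (suc t)) ⊎ (k ≤ n × Crossing k R)
walk zero refl i<k k≤ W with ≤-antisym k≤ i<k
... | refl = inj₁ (refl , walk-last W)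
walk (suc t) {n} {k} {i} refl i<k k≤ W with m≤n⇒m<n∨m≡n i<k
... | inj₂ si≡k = inj₂ (k≤n , walk-crossing W si≡k k≤n)
  where
  k≤n : k ≤ n
  k≤n = subst (_≤ n) si≡k (s≤s (m≤n+m i t))
... | inj₁ si<k with walk-step W si<k k≤
...   | R′ , p , W′ with walk t (+-suc t i) si<k k≤ W′
...     | inj₁ (k≡ , q) = inj₁ (k≡ , ↭-trans p (prep _ (prep _ q)))
...     | inj₂ (k≤n , b , m , rest , sb≡k , k<m , q) =
  inj₂ (k≤n , b , m , e ∷ e ∷ rest , sb≡k , k<m ,
        ↭-trans p (↭-trans (prep e (prep e q)) (shift (b , m) (e ∷ e ∷ []) rest)))
  where e = (i , suc i)

indeg-2≥2 : ∀ {n E} → 1 ≤ n → InF3 n E → ∃[ c ] indeg E 2 ≡ suc (suc c)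
indeg-2≥2 {suc zero}    _ (_ , _ , _ , _ , _ , _ , inₙ) = 1 , inₙ
indeg-2≥2 {suc (suc _)} _ (_ , _ , _ , _ , _ , in′ , _) = 0 , in′ 2 ≤-refl (s≤s (s≤s z≤n))

out-edge-from-1 : ∀ {n E} → 1 ≤ n → InF3 n E →
                  ∃[ k ] ∃[ R ] (E ↭ (1 , k) ∷ R) × (k ≤ n → 2 < k)
out-edge-from-1 {n} {E} 1≤n F@(wf , out₁ , _ , _ , _ , in′ , _)
  with peel-two-edges (All.map proj₁ wf) (ascending wf) (proj₂ (indeg-2≥2 1≤n F))
... | R₂ , p₂ with degree-suc-inv proj₁ 1 R₂ outdeg₁≡1
  where
  outdeg₁≡1 : outdeg R₂ 1 ≡ 1
  outdeg₁≡1 = suc-injective (suc-injective (trans (sym (degree-↭-∷∷-≡ p₂ refl)) out₁))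
...   | (s , k) , R₃ , refl , p₃ = k , (1 , 2) ∷ (1 , 2) ∷ R₃ , E↭ , 2<k
  where
  E↭ : E ↭ (1 , k) ∷ (1 , 2) ∷ (1 , 2) ∷ R₃
  E↭ = ↭-trans p₂ (↭-trans (prep _ (prep _ p₃)) (shift (1 , k) ((1 , 2) ∷ (1 , 2) ∷ []) R₃))
  2<k : k ≤ n → 2 < k
  2<k k≤n with k ≟ 2 | proj₁ (proj₂ (proj₁ (All-↭-∷⁻ E↭ wf)))
  ... | no k≢2 | 1<k = ≤∧≢⇒< 1<k (k≢2 ∘ sym)
  ... | yes refl | _ = ⊥-elim (<-irrefl (sym (in′ 2 ≤-refl k≤n)) indeg₂≥3)
    where
    indeg₂≥3 : 2 < indeg E 2
    indeg₂≥3 = subst (2 <_) (sym (degree-↭ proj₂ 2 E↭)) (s≤s (s≤s (s≤s z≤n)))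

potential : EdgeList → ℕ
potential = sum ∘ map (λ e → proj₁ e * proj₂ e)

potential-↭ : ∀ {R S} → R ↭ S → potential R ≡ potential S
potential-↭ = sum-↭ ∘ map⁺ _

*-+-rearrangement-< : ∀ {a b c d} → a < b → c < d → a * d + b * c < a * c + b * d
*-+-rearrangement-< {a} {b} {c} {d} a<b c<d
  with m≤n⇒∃[o]m+o≡n a<b | m≤n⇒∃[o]m+o≡n c<d
... | u , refl | w , refl = subst (a * d + b * c <_) (sym cross-difference) (m<m+n _ z<s)
  where
  open +-*-Solver
  cross-difference : a * c + (suc a + u) * (suc c + w)
                   ≡ a * (suc c + w) + (suc a + u) * c + suc u * suc w
  cross-difference = solve 4 (λ a u c w →
    a :* c :+ (con 1 :+ a :+ u) :* (con 1 :+ c :+ w)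
    := a :* (con 1 :+ c :+ w) :+ (con 1 :+ a :+ u) :* c :+ (con 1 :+ u) :* (con 1 :+ w))
    refl a u c w

potential-interchange : ∀ {G H} → Interchange G H → potential G < potential H
potential-interchange {G} {H} (a , b , c , d , rest , a<b , b<c , c<d , G↭ , H↭) = begin-strict
  potential G                ≡⟨ potential-↭ G↭ ⟩
  a * d + (b * c + r)        ≡⟨ +-assoc (a * d) (b * c) r ⟨
  a * d + b * c + r          <⟨ +-monoˡ-< r (*-+-rearrangement-< a<b c<d) ⟩
  a * c + b * d + r          ≡⟨ +-assoc (a * c) (b * d) r ⟩
  a * c + (b * d + r)        ≡⟨ potential-↭ H↭ ⟨
  potential H                ∎
  where
  open ≤-Reasoning
  r = potential rest

interchange-outdeg : ∀ {G H} v → Interchange G H → outdeg G v ≡ outdeg H v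
interchange-outdeg {G} {H} v (a , b , c , d , rest , _ , _ , _ , G↭ , H↭) = begin
  outdeg G v                                  ≡⟨ degree-↭ proj₁ v G↭ ⟩
  outdeg ((a , d) ∷ (b , c) ∷ rest) v          ≡⟨ expand ⟩
  δ a v + (δ b v + outdeg rest v)              ≡⟨ expand ⟨
  outdeg ((a , c) ∷ (b , d) ∷ rest) v          ≡⟨ degree-↭ proj₁ v H↭ ⟨
  outdeg H v                                  ∎
  where
  open ≡-Reasoning
  expand : ∀ {x y} → outdeg ((a , x) ∷ (b , y) ∷ rest) v ≡ δ a v + (δ b v + outdeg rest v)
  expand {x} {y} = trans (degree-∷ proj₁ v (a , x) _) (cong (δ a v +_) (degree-∷ proj₁ v (b , y) rest))

interchange-indeg : ∀ {G H} v → Interchange G H → indeg G v ≡ indeg H v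
interchange-indeg {G} {H} v (a , b , c , d , rest , _ , _ , _ , G↭ , H↭) = begin
  indeg G v                                   ≡⟨ degree-↭ proj₂ v G↭ ⟩
  indeg ((a , d) ∷ (b , c) ∷ rest) v           ≡⟨ expand d c ⟩
  δ d v + (δ c v + indeg rest v)               ≡⟨ +-assoc (δ d v) _ _ ⟨
  δ d v + δ c v + indeg rest v                 ≡⟨ cong (_+ indeg rest v) (+-comm (δ d v) (δ c v)) ⟩
  δ c v + δ d v + indeg rest v                 ≡⟨ +-assoc (δ c v) _ _ ⟩
  δ c v + (δ d v + indeg rest v)               ≡⟨ expand c d ⟨
  indeg ((a , c) ∷ (b , d) ∷ rest) v           ≡⟨ degree-↭ proj₂ v H↭ ⟨
  indeg H v                                   ∎
  where
  open ≡-Reasoning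
  expand : ∀ x y → indeg ((a , x) ∷ (b , y) ∷ rest) v ≡ δ x v + (δ y v + indeg rest v)
  expand x y = trans (degree-∷ proj₂ v (a , x) _) (cong (δ x v +_) (degree-∷ proj₂ v (b , y) rest))

wellFormed-interchange⁻ : ∀ {n G H} → Interchange G H → WellFormed n H → WellFormed n G
wellFormed-interchange⁻ (a , b , c , d , rest , a<b , b<c , c<d , G↭ , H↭) wf
  with All-resp-↭ H↭ wf
... | (1≤a , _ , c≤) ∷ (_ , _ , d≤) ∷ wf-rest =
  All-resp-↭ (↭-sym G↭)
    ((1≤a , <-trans (<-trans a<b b<c) c<d , d≤) ∷ (≤-trans 1≤a (<⇒≤ a<b) , b<c , c≤) ∷ wf-rest)

InF3-interchange⁻ : ∀ {n G H} → Interchange G H → InF3 n H → InF3 n G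
InF3-interchange⁻ {n} G→H (wf , out₁ , out , outₙ , in₁ , in′ , inₙ) =
  wellFormed-interchange⁻ G→H wf ,
  trans (interchange-outdeg 1 G→H) out₁ ,
  (λ v 2≤v v≤n → trans (interchange-outdeg v G→H) (out v 2≤v v≤n)) ,
  trans (interchange-outdeg (suc n) G→H) outₙ ,
  trans (interchange-indeg 1 G→H) in₁ ,
  (λ v 2≤v v≤n → trans (interchange-indeg v G→H) (in′ v 2≤v v≤n)) ,
  trans (interchange-indeg (suc n) G→H) inₙ

reachable-▻ : ∀ {G H I} → Reachable G H → Interchange H I → Reachable G I
reachable-▻ (K , G⇝K , K↭H) (a , b , c , d , rest , a<b , b<c , c<d , H↭ , I↭) =
  _ , G⇝K ◅◅ ((a , b , c , d , rest , a<b , b<c , c<d , ↭-trans K↭H H↭ , I↭) ◅ ε) , ↭-refl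

G₀-or-interchange : ∀ {n E} → 1 ≤ n → InF3 n E → (E ↭ G₀ n) ⊎ ∃[ G ] Interchange G E
G₀-or-interchange {suc n} {E} 1≤n F with out-edge-from-1 1≤n F
... | k , R , E↭ , 2<k
  with _ , 1<k , k≤ ← proj₁ (All-↭-∷⁻ E↭ (proj₁ F))
  with walk n (+-comm n 1) 1<k k≤ (walk-start F E↭)
... | inj₁ (refl , R↭) = inj₁ (subst (E ↭_) (sym (G₀≡doubledPath (suc n))) (↭-trans E↭ (prep _ R↭)))
... | inj₂ (k≤n , b , m , rest , refl , k<m , R↭) =
  inj₂ (_ , 1 , b , suc b , m , rest , ≤-pred (2<k k≤n) , ≤-refl , k<m , ↭-refl , ↭-trans E↭ (prep _ R↭))

corollary3p20 : (n : ℕ) → 1 ≤ n → (E : EdgeList) → InF3 n E → Reachable (G₀ n) E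
corollary3p20 n 1≤n E = reach E (<-wellFounded (potential E))
  where
  reach : ∀ E → Acc _<_ (potential E) → InF3 n E → Reachable (G₀ n) E
  reach E (acc smaller) F with G₀-or-interchange 1≤n F
  ... | inj₁ E↭G₀ = G₀ n , ε , ↭-sym E↭G₀
  ... | inj₂ (G , G→E) =
    reachable-▻ (reach G (smaller (potential-interchange G→E)) (InF3-interchange⁻ G→E F)) G→E
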